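{- For every positive integer $d$, $\mathrm{nbet}\left(2^{2^d}\right)=d+1$.
   Context: An ordering of $[n]$ is a bijection $\phi:[n]\to[n]$. A ternary constraint is a triple $(x_1,x_2,x_3)$ of distinct elements of $[n]$. $\phi$ nonbetween-satisfies the constraint unless $\phi(x_1)<\phi(x_2)<\phi(x_3)$ or $\phi(x_3)<\phi(x_2)<\phi(x_1)$. $\mathrm{nbet}(n)$ is the minimum size of a set of orderings of $[n]$ such that every ternary constraint is nonbetween-satisfied by some ordering in the set. -}

module Defs where

open import Data.Nat using (ℕ; _<_; _≤_; _^_; suc)
open import Data.Fin using (Fin; toℕ)
open import Data.Fin.Permutation using (Permutation′; _⟨$⟩ʳ_)
open import Data.Product using (_×_; Σ; ∃-syntax)
open import Relation.Nullary using (¬_)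
open import Relation.Binary.PropositionalEquality using (_≢_)

Ordering : ℕ → Set
Ordering n = Permutation′ n

record Constraint (n : ℕ) : Set where
  constructor ⟨_,_,_⟩⟨_,_,_⟩
  field
    x₁ x₂ x₃ : Fin n
    d₁₂ : x₁ ≢ x₂
    d₁₃ : x₁ ≢ x₃
    d₂₃ : x₂ ≢ x₃

_<ᶠ_ : ∀ {n} → Fin n → Fin n → Set
a <ᶠ b = toℕ a < toℕ b

NonbetweenSat : ∀ {n} → Ordering n → Constraint n → Set
NonbetweenSat φ c =
  ¬ ((φ ⟨$⟩ʳ x₁) <ᶠ (φ ⟨$⟩ʳ x₂) × (φ ⟨$⟩ʳ x₂) <ᶠ (φ ⟨$⟩ʳ x₃))
  × ¬ ((φ ⟨$⟩ʳ x₃) <ᶠ (φ ⟨$⟩ʳ x₂) × (φ ⟨$⟩ʳ x₂) <ᶠ (φ ⟨$⟩ʳ x₁))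
  where open Constraint c

Covers : ∀ {n k} → (Fin k → Ordering n) → Set
Covers {n} {k} F = (c : Constraint n) → ∃[ i ] NonbetweenSat (F i) c

-- nbet(n) = m : m is the minimum size of a covering set of orderings.
-- (A family of size k with repetitions yields a set of size ≤ k, so minimising
-- over indexed families gives the same minimum as over sets.)
NbetIs : ℕ → ℕ → Set
NbetIs n m =
  Σ (Fin m → Ordering n) Covers
  × (∀ k → (F : Fin k → Ordering n) → Covers F → m ≤ k)

module Submission where

-- Everything is phrased through directions: for an ordering φ and two
-- elements x, y, 'dir φ x y' is true when φ places x before y.  For a
-- constraint (x₁,x₂,x₃), φ nonbetween-satisfies it exactly when φ "turns"
-- at x₂, i.e. the pairs (x₁,x₂) and (x₂,x₃) get different directions.
--
-- Given orderings F₀, …, F_m covering [n], list the elements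
-- in the order of F₀ and colour the pair (p,q), p before q, by the vector of
-- its directions in F₁, …, F_m.  A monochromatic path p < q < r would be a
-- constraint on which no Fᵢ turns.  A general chain lemma shows that a chain
-- whose edges use c colours and which has no monochromatic path of length
-- two has at most 2^c vertices; with c = 2^m this gives n ≤ 2^2^m.
--
-- From k+1 orderings F₀, …, F_k covering [m] we build k+2
-- lexicographic orderings of [m]×[m] ≅ [m·m] covering it:
-- F₀ ⊗ reversed F₀ and Fᵢ ⊗ Fᵢ.  Starting from one ordering of [2] and
-- squaring d times covers [2^2^d] with d+1 orderings.

open import Defs
open import Data.Nat using (ℕ; zero; suc; pred; _^_; _≤_; _<_; _+_; _*_; z≤n; s≤s; _<?_; _≤?_)
open import Data.Nat.Properties
open import Data.Bool as Bool using (Bool; true; false; not)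
open import Data.Bool.Properties using (not-¬)
open import Data.Fin as Fin using (Fin; toℕ; combine; remQuot; opposite)
open import Data.Fin.Properties as FinP
  using (toℕ-injective; toℕ<n; toℕ-combine; combine-remQuot; combine-monoˡ-<; opposite-prop; opposite-involutive; ¬Fin0; *↔×)
open import Data.Fin.Permutation using (_⟨$⟩ʳ_; _⟨$⟩ˡ_; inverseˡ; inverseʳ; _∘ₚ_; reverse)
import Data.Fin.Permutation as Perm
open import Data.Product using (_×_; Σ; _,_; proj₁; proj₂)
open import Data.Product.Function.NonDependent.Propositional using (_×-↔_)
open import Data.Sum using (_⊎_; inj₁; inj₂)
open import Data.Empty using (⊥; ⊥-elim)
open import Data.List using (List; []; _∷_; [_]; length; map; _++_; filter; allFin)
open import Data.List.Properties using (length-++; length-map; length-tabulate)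
open import Data.List.Relation.Unary.All as All using (All; []; _∷_)
open import Data.List.Relation.Unary.All.Properties using (all-filter)
open import Data.List.Relation.Unary.Any as Any using (Any; here; there; any?)
open import Data.List.Relation.Unary.AllPairs as AllPairs using (AllPairs; []; _∷_)
import Data.List.Relation.Unary.AllPairs.Properties as AllPairsP
open import Data.List.Membership.Propositional using (_∈_)
open import Data.List.Membership.Propositional.Properties using (∈-++⁺ˡ; ∈-++⁺ʳ; ∈-map⁺)
open import Data.Vec as Vec using (Vec; lookup; tabulate)
open import Data.Vec.Properties using (≡-dec; lookup∘tabulate)
open import Function using (_∘_)
open import Function.Construct.Composition using (_↔-∘_)
open import Function.Construct.Symmetry using (↔-sym)
open import Relation.Nullary using (¬_; yes; no; does; contradiction)
open import Relation.Nullary.Decidable using (_×-dec_; dec-true; dec-false)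
open import Relation.Unary using () renaming (Decidable to Decidable₁)
open import Relation.Unary.Properties using (∁?)
open import Relation.Binary.Definitions using (Decidable; DecidableEquality; tri<; tri≈; tri>)
open import Relation.Binary.PropositionalEquality
  using (_≡_; _≢_; refl; sym; trans; cong; cong₂; subst; subst₂; ≢-sym; module ≡-Reasoning)

ascends : ℕ → ℕ → Bool
ascends a b = does (a <? b)

ascends-true : ∀ {a b} → a < b → ascends a b ≡ true
ascends-true {a} {b} = dec-true (a <? b)

ascends-false : ∀ {a b} → ¬ a < b → ascends a b ≡ false
ascends-false {a} {b} = dec-false (a <? b)

ascends-cong : ∀ {a b c d} → (a < b → c < d) → (c < d → a < b) → ascends a b ≡ ascends c d
ascends-cong {a} {b} to from with a <? b
... | yes a<b = trans (ascends-true a<b) (sym (ascends-true (to a<b)))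
... | no a≮b  = trans (ascends-false a≮b) (sym (ascends-false (a≮b ∘ from)))

ascends-swap : ∀ {a b} → a ≢ b → ascends b a ≡ not (ascends a b)
ascends-swap {a} {b} a≢b with a <? b
... | yes a<b = trans (ascends-false (<-asym a<b)) (cong not (sym (ascends-true a<b)))
... | no a≮b  = trans (ascends-true (≤∧≢⇒< (≮⇒≥ a≮b) (≢-sym a≢b))) (cong not (sym (ascends-false a≮b)))

Nonbetween : ℕ → ℕ → ℕ → Set
Nonbetween a b c = ¬ (a < b × b < c) × ¬ (c < b × b < a)

turn⇒nonbetween : ∀ {a b c} → ascends a b ≢ ascends b c → Nonbetween a b c
turn⇒nonbetween turn =
  (λ (a<b , b<c) → turn (trans (ascends-true a<b) (sym (ascends-true b<c)))) ,
  (λ (c<b , b<a) → turn (trans (ascends-false (<-asym b<a)) (sym (ascends-false (<-asym c<b)))))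

nonbetween⇒turn : ∀ {a b c} → a ≢ b → b ≢ c → Nonbetween a b c → ascends a b ≢ ascends b c
nonbetween⇒turn {a} {b} {c} a≢b b≢c (¬ascending , ¬descending) same with a <? b | b <? c
... | yes a<b | yes b<c = ¬ascending (a<b , b<c)
... | no a≮b  | no b≮c  = ¬descending (≤∧≢⇒< (≮⇒≥ b≮c) (≢-sym b≢c) , ≤∧≢⇒< (≮⇒≥ a≮b) (≢-sym a≢b))
... | yes a<b | no b≮c  = contradiction (trans (sym (ascends-true a<b)) (trans same (ascends-false b≮c))) λ ()
... | no a≮b  | yes b<c = contradiction (trans (sym (ascends-false a≮b)) (trans same (ascends-true b<c))) λ ()

differs-from-one : ∀ a b → a ≢ b ⊎ not a ≢ b
differs-from-one true  true  = inj₂ (λ ())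
differs-from-one true  false = inj₁ (λ ())
differs-from-one false true  = inj₁ (λ ())
differs-from-one false false = inj₂ (λ ())

≢-transport : ∀ {A : Set} {a a′ b b′ : A} → a ≡ a′ → b ≡ b′ → a′ ≢ b′ → a ≢ b
≢-transport refl refl a′≢b′ = a′≢b′

position : ∀ {n} → Ordering n → Fin n → ℕ
position φ x = toℕ (φ ⟨$⟩ʳ x)

position-injective : ∀ {n} (φ : Ordering n) {x y} → position φ x ≡ position φ y → x ≡ y
position-injective φ {x} {y} eq = begin
  x                    ≡⟨ inverseˡ φ ⟨
  φ ⟨$⟩ˡ (φ ⟨$⟩ʳ x)   ≡⟨ cong (φ ⟨$⟩ˡ_) (toℕ-injective eq) ⟩
  φ ⟨$⟩ˡ (φ ⟨$⟩ʳ y)   ≡⟨ inverseˡ φ ⟩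
  y                    ∎
  where open ≡-Reasoning

dir : ∀ {n} → Ordering n → Fin n → Fin n → Bool
dir φ x y = ascends (position φ x) (position φ y)

TurnsAt : ∀ {n} → Ordering n → Constraint n → Set
TurnsAt φ c = dir φ x₁ x₂ ≢ dir φ x₂ x₃
  where open Constraint c

turns⇒sat : ∀ {n} (φ : Ordering n) (c : Constraint n) → TurnsAt φ c → NonbetweenSat φ c
turns⇒sat φ c = turn⇒nonbetween

sat⇒turns : ∀ {n} (φ : Ordering n) (c : Constraint n) → NonbetweenSat φ c → TurnsAt φ c
sat⇒turns φ c = nonbetween⇒turn (d₁₂ ∘ position-injective φ) (d₂₃ ∘ position-injective φ)
  where open Constraint c

reversed : ∀ {n} → Ordering n → Ordering n
reversed φ = φ ∘ₚ reverse

opposite-< : ∀ {n} {i j : Fin n} → toℕ i < toℕ j → toℕ (opposite j) < toℕ (opposite i)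
opposite-< {_} {i} {j} i<j rewrite opposite-prop i | opposite-prop j = ∸-monoʳ-< (s≤s i<j) (toℕ<n j)

dir-reversed : ∀ {n} (φ : Ordering n) {x y} → x ≢ y → dir (reversed φ) x y ≡ not (dir φ x y)
dir-reversed φ {x} {y} x≢y = begin
  ascends (toℕ (opposite u)) (toℕ (opposite v)) ≡⟨ ascends-cong back opposite-< ⟩
  ascends (toℕ v) (toℕ u)                       ≡⟨ ascends-swap (x≢y ∘ position-injective φ) ⟩
  not (dir φ x y)                               ∎
  where
  open ≡-Reasoning
  u v : Fin _
  u = φ ⟨$⟩ʳ x
  v = φ ⟨$⟩ʳ y
  back : toℕ (opposite u) < toℕ (opposite v) → toℕ v < toℕ u
  back opp-u<opp-v =
    subst₂ (λ s t → toℕ s < toℕ t) (opposite-involutive v) (opposite-involutive u) (opposite-< opp-u<opp-v)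

-- If the colours of the edges lie in a list cs, the chain has
-- at most 2^|cs| vertices: for a colour c, the vertices entered by a c-edge
-- and the remaining ones each form a chain without c-edges.

attach : ∀ {A : Set} {R : A → A → Set} {P : A → Set} {xs} →
         AllPairs R xs → All P xs → AllPairs (λ x y → P x × R x y × P y) xs
attach [] [] = []
attach (Rx ∷ Rxs) (Px ∷ Pxs) = All.zipWith (λ (Rxy , Py) → Px , Rxy , Py) (Rx , Pxs) ∷ attach Rxs Pxs

length-filter-split : ∀ {A : Set} {P : A → Set} (P? : Decidable₁ P) xs →
                      length xs ≡ length (filter P? xs) + length (filter (∁? P?) xs)
length-filter-split P? [] = refl
length-filter-split P? (x ∷ xs) with P? x
... | yes _ = cong suc (length-filter-split P? xs)
... | no _  = trans (cong suc (length-filter-split P? xs)) (sym (+-suc _ _))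

module ChainBound {V C : Set} (_≺_ : V → V → Set) (_≺?_ : Decidable _≺_)
                  (colour : V → V → C) (_≟_ : DecidableEquality C)
                  (no-monochromatic-path : ∀ {w x y} → w ≺ x → x ≺ y → colour w x ≢ colour x y) where

  Edge : List C → V → V → Set
  Edge cs x y = x ≺ y × colour x y ∈ cs

  chain-bound : ∀ cs vs → AllPairs (Edge cs) vs → length vs ≤ 2 ^ length cs
  chain-bound []       []              _ = z≤n
  chain-bound []       (_ ∷ [])        _ = ≤-refl
  chain-bound []       (_ ∷ _ ∷ _)     (((_ , ()) ∷ _) ∷ _)
  chain-bound (c ∷ cs) vs edges = begin
    length vs                               ≡⟨ length-filter-split Entered? vs ⟩
    length entered + length unentered       ≤⟨ +-mono-≤ (chain-bound cs entered entered-edges)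
                                                        (chain-bound cs unentered unentered-edges) ⟩
    2 ^ length cs + 2 ^ length cs           ≡⟨ cong (2 ^ length cs +_) (+-identityʳ _) ⟨
    2 ^ length (c ∷ cs)                     ∎
    where
    open ≤-Reasoning

    Entered : V → Set
    Entered y = Any (λ w → w ≺ y × colour w y ≡ c) vs

    Entered? : Decidable₁ Entered
    Entered? y = any? (λ w → (w ≺? y) ×-dec (colour w y ≟ c)) vs

    entered unentered : List V
    entered   = filter Entered? vs
    unentered = filter (∁? Entered?) vs

    -- An edge leaving an entered vertex cannot have colour c.
    entered-edges : AllPairs (Edge cs) entered
    entered-edges = AllPairs.map drop-c (attach (AllPairsP.filter⁺ Entered? edges) (all-filter Entered? vs))
      where
      drop-c : ∀ {x y} → Entered x × Edge (c ∷ cs) x y × Entered y → Edge cs x y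
      drop-c (_ , (x≺y , there c∈cs) , _) = x≺y , c∈cs
      drop-c (x-entered , (x≺y , here xy≡c) , _) with Any.satisfied x-entered
      ... | _ , w≺x , wx≡c = contradiction (trans wx≡c (sym xy≡c)) (no-monochromatic-path w≺x x≺y)

    -- An edge of colour c would enter its head.
    unentered-edges : AllPairs (Edge cs) unentered
    unentered-edges = AllPairs.map drop-c
      (attach (AllPairsP.filter⁺ (∁? Entered?) (attach edges (All.tabulate (λ x∈vs → x∈vs))))
              (all-filter (∁? Entered?) vs))
      where
      drop-c : ∀ {x y} → ¬ Entered x × (x ∈ vs × Edge (c ∷ cs) x y × y ∈ vs) × ¬ Entered y → Edge cs x y
      drop-c (_ , (_ , (x≺y , there c∈cs) , _) , _) = x≺y , c∈cs
      drop-c (_ , (x∈vs , (x≺y , here xy≡c) , _) , y-unentered) =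
        contradiction (Any.map (λ { refl → x≺y , xy≡c }) x∈vs) y-unentered

bitVectors : ∀ m → List (Vec Bool m)
bitVectors zero    = [ Vec.[] ]
bitVectors (suc m) = map (true Vec.∷_) (bitVectors m) ++ map (false Vec.∷_) (bitVectors m)

length-bitVectors : ∀ m → length (bitVectors m) ≡ 2 ^ m
length-bitVectors zero    = refl
length-bitVectors (suc m) = begin
  length (map (true Vec.∷_) vs ++ map (false Vec.∷_) vs)
                                                     ≡⟨ length-++ (map (true Vec.∷_) vs) ⟩
  length (map (true Vec.∷_) vs) + length (map (false Vec.∷_) vs)
                                                     ≡⟨ cong₂ _+_ (length-map _ vs) (length-map _ vs) ⟩
  length vs + length vs                              ≡⟨ cong₂ _+_ (length-bitVectors m) (length-bitVectors m) ⟩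
  2 ^ m + 2 ^ m                                      ≡⟨ cong (2 ^ m +_) (+-identityʳ _) ⟨
  2 ^ suc m                                          ∎
  where
  open ≡-Reasoning
  vs : List (Vec Bool m)
  vs = bitVectors m

bitVectors-complete : ∀ {m} (v : Vec Bool m) → v ∈ bitVectors m
bitVectors-complete Vec.[]           = here refl
bitVectors-complete (true Vec.∷ v)  = ∈-++⁺ˡ (∈-map⁺ _ (bitVectors-complete v))
bitVectors-complete (false Vec.∷ v) = ∈-++⁺ʳ _ (∈-map⁺ _ (bitVectors-complete v))

module FirstOrderingChain {n m : ℕ} (F : Fin (suc m) → Ordering n) (cov : Covers F) where

  elementAt : Fin n → Fin n
  elementAt p = F Fin.zero ⟨$⟩ˡ p

  position-elementAt : ∀ p → position (F Fin.zero) (elementAt p) ≡ toℕ p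
  position-elementAt p = cong toℕ (inverseʳ (F Fin.zero))

  elementAt-distinct : ∀ {p q : Fin n} → p Fin.< q → elementAt p ≢ elementAt q
  elementAt-distinct p<q eq = <-irrefl (trans (sym (position-elementAt _))
                                        (trans (cong (position (F Fin.zero)) eq) (position-elementAt _))) p<q

  first-ascends : ∀ {p q : Fin n} → p Fin.< q → dir (F Fin.zero) (elementAt p) (elementAt q) ≡ true
  first-ascends {p} {q} p<q = trans (cong₂ ascends (position-elementAt p) (position-elementAt q)) (ascends-true p<q)

  colour : Fin n → Fin n → Vec Bool m
  colour p q = tabulate (λ i → dir (F (Fin.suc i)) (elementAt p) (elementAt q))

  colour-component : ∀ {p q r} i → colour p q ≡ colour q r →
    dir (F (Fin.suc i)) (elementAt p) (elementAt q) ≡ dir (F (Fin.suc i)) (elementAt q) (elementAt r)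
  colour-component i same =
    trans (sym (lookup∘tabulate _ i)) (trans (cong (λ v → lookup v i) same) (lookup∘tabulate _ i))

  pathConstraint : ∀ {p q r : Fin n} → p Fin.< q → q Fin.< r → Constraint n
  pathConstraint {p} {q} {r} p<q q<r = ⟨ elementAt p , elementAt q , elementAt r ⟩⟨
    elementAt-distinct p<q , elementAt-distinct (<-trans p<q q<r) , elementAt-distinct q<r ⟩

  -- A monochromatic path would be a constraint on which no ordering turns.
  no-monochromatic-path : ∀ {p q r : Fin n} → p Fin.< q → q Fin.< r → colour p q ≢ colour q r
  no-monochromatic-path p<q q<r same with cov (pathConstraint p<q q<r)
  ... | Fin.zero , sat =
    sat⇒turns (F Fin.zero) (pathConstraint p<q q<r) sat (trans (first-ascends p<q) (sym (first-ascends q<r)))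
  ... | Fin.suc i , sat =
    sat⇒turns (F (Fin.suc i)) (pathConstraint p<q q<r) sat (colour-component i same)

  open ChainBound Fin._<_ FinP._<?_ colour (≡-dec Bool._≟_) no-monochromatic-path

  size-bound : n ≤ 2 ^ 2 ^ m
  size-bound = begin
    n                          ≡⟨ length-tabulate (λ p → p) ⟨
    length (allFin n)          ≤⟨ chain-bound (bitVectors m) (allFin n) positions-chain ⟩
    2 ^ length (bitVectors m)  ≡⟨ cong (2 ^_) (length-bitVectors m) ⟩
    2 ^ 2 ^ m                  ∎
    where
    open ≤-Reasoning
    positions-chain : AllPairs (Edge (bitVectors m)) (allFin n)
    positions-chain = AllPairsP.tabulate⁺-< (λ p<q → p<q , bitVectors-complete _)

-- A covering family of k orderings of [n] forces n ≤ 2^2^(k-1).  An empty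
-- family covers only when there are no constraints, and then the identity
-- ordering alone covers as well.
nbet-lower : ∀ {n} k (F : Fin k → Ordering n) → Covers F → n ≤ 2 ^ 2 ^ pred k
nbet-lower zero    F cov = FirstOrderingChain.size-bound {m = 0} (λ _ → Perm.id) (λ c → ⊥-elim (¬Fin0 (proj₁ (cov c))))
nbet-lower (suc m) F cov = FirstOrderingChain.size-bound F cov

module Lexicographic (m n : ℕ) where

  block : Fin (m * n) → Fin m
  block x = proj₁ (remQuot {m} n x)

  offset : Fin (m * n) → Fin n
  offset x = proj₂ (remQuot {m} n x)

  offset-distinct : ∀ {x y} → block x ≡ block y → x ≢ y → offset x ≢ offset y
  offset-distinct {x} {y} same-block x≢y same-offset = x≢y (begin
    x                              ≡⟨ combine-remQuot {m} n x ⟨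
    combine (block x) (offset x)   ≡⟨ cong₂ combine same-block same-offset ⟩
    combine (block y) (offset y)   ≡⟨ combine-remQuot {m} n y ⟩
    y                              ∎)
    where open ≡-Reasoning

  -- Order the blocks by σ and each block by τ.
  _⊗_ : Ordering m → Ordering n → Ordering (m * n)
  σ ⊗ τ = ↔-sym *↔× ↔-∘ ((σ ×-↔ τ) ↔-∘ *↔×)

  combine-<-block : ∀ {i k : Fin m} {j l : Fin n} → i ≢ k → combine i j Fin.< combine k l → i Fin.< k
  combine-<-block {i} {k} {j} {l} i≢k ij<kl with FinP.<-cmp i k
  ... | tri< i<k _ _ = i<k
  ... | tri≈ _ i≡k _ = contradiction i≡k i≢k
  ... | tri> _ _ k<i = contradiction (combine-monoˡ-< l j k<i) (<-asym ij<kl)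

  dir-⊗-outer : ∀ σ τ {x y} → block x ≢ block y → dir (σ ⊗ τ) x y ≡ dir σ (block x) (block y)
  dir-⊗-outer σ τ blocks-differ =
    ascends-cong (combine-<-block (blocks-differ ∘ position-injective σ ∘ cong toℕ)) (combine-monoˡ-< _ _)

  dir-⊗-inner : ∀ σ τ {x y} → block x ≡ block y → dir (σ ⊗ τ) x y ≡ dir τ (offset x) (offset y)
  dir-⊗-inner σ τ {x} {y} same-block = begin
    dir (σ ⊗ τ) x y                  ≡⟨ cong₂ ascends (toℕ-combine (σ ⟨$⟩ʳ block x) _) (toℕ-combine (σ ⟨$⟩ʳ block y) _) ⟩
    ascends (n * B + position τ (offset x)) (n * position σ (block y) + position τ (offset y))
                                     ≡⟨ cong (λ b → ascends (n * B + _) (n * position σ b + _)) (sym same-block) ⟩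
    ascends (n * B + position τ (offset x)) (n * B + position τ (offset y))
                                     ≡⟨ ascends-cong (+-cancelˡ-< (n * B) _ _) (+-monoʳ-< (n * B)) ⟩
    dir τ (offset x) (offset y)      ∎
    where
    open ≡-Reasoning
    B : ℕ
    B = position σ (block x)

  turns-inner : ∀ σ τ {x y z} → block x ≡ block y → block y ≡ block z →
    dir τ (offset x) (offset y) ≢ dir τ (offset y) (offset z) → dir (σ ⊗ τ) x y ≢ dir (σ ⊗ τ) y z
  turns-inner σ τ bxy byz = ≢-transport (dir-⊗-inner σ τ bxy) (dir-⊗-inner σ τ byz)

  turns-outer : ∀ σ τ {x y z} → block x ≢ block y → block y ≢ block z →
    dir σ (block x) (block y) ≢ dir σ (block y) (block z) → dir (σ ⊗ τ) x y ≢ dir (σ ⊗ τ) y z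
  turns-outer σ τ bxy byz = ≢-transport (dir-⊗-outer σ τ bxy) (dir-⊗-outer σ τ byz)

  turns-returning : ∀ σ τ {x y z} → block x ≢ block y → block x ≡ block z → dir (σ ⊗ τ) x y ≢ dir (σ ⊗ τ) y z
  turns-returning σ τ {x} {y} {z} bxy bxz =
    ≢-transport (dir-⊗-outer σ τ bxy) back-out (not-¬ refl)
    where
    byz : block y ≢ block z
    byz byz≡ = bxy (trans bxz (sym byz≡))
    back-out : dir (σ ⊗ τ) y z ≡ not (dir σ (block x) (block y))
    back-out = begin
      dir (σ ⊗ τ) y z               ≡⟨ dir-⊗-outer σ τ byz ⟩
      dir σ (block y) (block z)     ≡⟨ cong (dir σ (block y)) bxz ⟨
      dir σ (block y) (block x)     ≡⟨ ascends-swap (bxy ∘ position-injective σ) ⟩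
      not (dir σ (block x) (block y)) ∎
      where open ≡-Reasoning

module Squaring {m k : ℕ} (F : Fin (suc k) → Ordering m) (cov : Covers F) where
  open Lexicographic m m

  σ₀ : Ordering m
  σ₀ = F Fin.zero

  squared : Fin (suc (suc k)) → Ordering (m * m)
  squared Fin.zero    = σ₀ ⊗ reversed σ₀
  squared (Fin.suc i) = F i ⊗ F i

  squared-covers : Covers squared
  squared-covers c@(⟨ x , y , z ⟩⟨ x≢y , x≢z , y≢z ⟩)
    with block x FinP.≟ block y | block y FinP.≟ block z | block x FinP.≟ block z
  -- One block: some Fᵢ ⊗ Fᵢ works, as Fᵢ covers the offsets.
  ... | yes bxy | yes byz | _ =
    let c′ = ⟨ offset x , offset y , offset z ⟩⟨ offset-distinct bxy x≢y ,
               offset-distinct (trans bxy byz) x≢z , offset-distinct byz y≢z ⟩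
        (i , sat) = cov c′
    in Fin.suc i , turns⇒sat (squared (Fin.suc i)) c (turns-inner (F i) (F i) bxy byz (sat⇒turns (F i) c′ sat))
  -- Three blocks: some Fᵢ ⊗ Fᵢ works, as Fᵢ covers the blocks.
  ... | no bxy | no byz | no bxz =
    let c′ = ⟨ block x , block y , block z ⟩⟨ bxy , bxz , byz ⟩
        (i , sat) = cov c′
    in Fin.suc i , turns⇒sat (squared (Fin.suc i)) c (turns-outer (F i) (F i) bxy byz (sat⇒turns (F i) c′ sat))
  -- x and z share a block that y avoids: σ₀ ⊗ reversed σ₀ works.
  ... | no bxy | no _ | yes bxz =
    Fin.zero , turns⇒sat (squared Fin.zero) c (turns-returning σ₀ (reversed σ₀) bxy bxz)
  -- Exactly one consecutive pair shares a block: σ₀ ⊗ σ₀ and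
  -- σ₀ ⊗ reversed σ₀ agree on the other pair and disagree on this one.
  ... | yes bxy | no byz | _
    with differs-from-one (dir σ₀ (offset x) (offset y)) (dir σ₀ (block y) (block z))
  ...   | inj₁ t≢s = Fin.suc Fin.zero , turns⇒sat (squared (Fin.suc Fin.zero)) c
            (≢-transport (dir-⊗-inner σ₀ σ₀ bxy) (dir-⊗-outer σ₀ σ₀ byz) t≢s)
  ...   | inj₂ t≢s = Fin.zero , turns⇒sat (squared Fin.zero) c
            (≢-transport (trans (dir-⊗-inner σ₀ (reversed σ₀) bxy) (dir-reversed σ₀ (offset-distinct bxy x≢y)))
                         (dir-⊗-outer σ₀ (reversed σ₀) byz) t≢s)
  squared-covers c@(⟨ x , y , z ⟩⟨ x≢y , x≢z , y≢z ⟩) | no bxy | yes byz | _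
    with differs-from-one (dir σ₀ (offset y) (offset z)) (dir σ₀ (block x) (block y))
  ...   | inj₁ t≢s = Fin.suc Fin.zero , turns⇒sat (squared (Fin.suc Fin.zero)) c
            (≢-transport (dir-⊗-outer σ₀ σ₀ bxy) (dir-⊗-inner σ₀ σ₀ byz) (≢-sym t≢s))
  ...   | inj₂ t≢s = Fin.zero , turns⇒sat (squared Fin.zero) c
            (≢-transport (dir-⊗-outer σ₀ (reversed σ₀) bxy)
                         (trans (dir-⊗-inner σ₀ (reversed σ₀) byz) (dir-reversed σ₀ (offset-distinct byz y≢z)))
                         (≢-sym t≢s))

no-constraint-on-two : Constraint 2 → ⊥
no-constraint-on-two ⟨ Fin.zero , Fin.zero , _ ⟩⟨ x≢y , _ , _ ⟩ = x≢y refl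
no-constraint-on-two ⟨ Fin.suc Fin.zero , Fin.suc Fin.zero , _ ⟩⟨ x≢y , _ , _ ⟩ = x≢y refl
no-constraint-on-two ⟨ Fin.zero , Fin.suc Fin.zero , Fin.zero ⟩⟨ _ , x≢z , _ ⟩ = x≢z refl
no-constraint-on-two ⟨ Fin.zero , Fin.suc Fin.zero , Fin.suc Fin.zero ⟩⟨ _ , _ , y≢z ⟩ = y≢z refl
no-constraint-on-two ⟨ Fin.suc Fin.zero , Fin.zero , Fin.zero ⟩⟨ _ , _ , y≢z ⟩ = y≢z refl
no-constraint-on-two ⟨ Fin.suc Fin.zero , Fin.zero , Fin.suc Fin.zero ⟩⟨ _ , x≢z , _ ⟩ = x≢z refl

square-double-exp : ∀ d → 2 ^ 2 ^ d * 2 ^ 2 ^ d ≡ 2 ^ 2 ^ suc d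
square-double-exp d = trans (sym (^-distribˡ-+-* 2 (2 ^ d) (2 ^ d))) (cong (λ e → 2 ^ (2 ^ d + e)) (sym (+-identityʳ _)))

covering-family : ∀ d → Σ (Fin (suc d) → Ordering (2 ^ 2 ^ d)) Covers
covering-family zero    = (λ _ → Perm.id) , λ c → ⊥-elim (no-constraint-on-two c)
covering-family (suc d) = subst (λ n → Σ (Fin (suc (suc d)) → Ordering n) Covers) (square-double-exp d)
                                (Squaring.squared F cov , Squaring.squared-covers F cov)
  where
  F : Fin (suc d) → Ordering (2 ^ 2 ^ d)
  F = proj₁ (covering-family d)
  cov : Covers F
  cov = proj₂ (covering-family d)

double-exp-mono-< : ∀ {a b} → a < b → 2 ^ 2 ^ a < 2 ^ 2 ^ b
double-exp-mono-< a<b = ^-monoʳ-< 2 (s≤s (s≤s z≤n)) (^-monoʳ-< 2 (s≤s (s≤s z≤n)) a<b)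

pred-below : ∀ {k d} → 1 ≤ d → k ≤ d → pred k < d
pred-below {zero}  1≤d _   = 1≤d
pred-below {suc _} _   k≤d = k≤d

lemma2p6 : (d : ℕ) → 1 ≤ d → NbetIs (2 ^ (2 ^ d)) (suc d)
lemma2p6 d 1≤d = covering-family d , minimal
  where
  -- Fewer than d+1 orderings cover at most 2^2^(d-1) < 2^2^d elements.
  minimal : ∀ k (F : Fin k → Ordering (2 ^ 2 ^ d)) → Covers F → suc d ≤ k
  minimal k F cov with suc d ≤? k
  ... | yes d<k = d<k
  ... | no d≮k  = contradiction (nbet-lower k F cov) (<⇒≱ (double-exp-mono-< (pred-below 1≤d (≮⇒≥ d≮k))))
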